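{- Let $G$ be a graph. Then $G$ is perfect if and only if $\eta(H)\leq \omega(H)$ for every induced subgraph $H$ of $G$.
   Context: All graphs are finite and simple. A graph $G$ is perfect if $\chi(H)\leq\omega(H)$ for every induced subgraph $H$ of $G$, where $\chi$ is the chromatic number and $\omega$ the clique number. $\alpha(G)$ is the stability number; a maximum stable set is a stable set of size $\alpha(G)$. $\eta(G)$ is the smallest cardinality of a set $X\subseteq V(G)$ meeting every maximum stable set of $G$. -}

module Defs where

open import Data.Nat using (ℕ; suc; _≤_)
open import Data.Bool using (Bool; true; false)
open import Data.Fin using (Fin)
open import Data.Fin.Subset using (Subset; _∈_; ∣_∣)
open import Data.Product using (Σ; ∃; _×_; _,_)
open import Relation.Binary.PropositionalEquality using (_≡_; _≢_)
open import Function.Definitions using (Injective)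

record Graph : Set where
  field
    n     : ℕ
    adj   : Fin n → Fin n → Bool
    sym   : ∀ i j → adj i j ≡ adj j i
    irrfl : ∀ i → adj i i ≡ false
open Graph public

-- The subgraph of G induced on the image of a map f : Fin m → V(G)
-- (for injective f this is, up to isomorphism, an induced subgraph).
induced : (G : Graph) {m : ℕ} → (Fin m → Fin (n G)) → Graph
induced G {m} f = record
  { n = m
  ; adj = λ i j → adj G (f i) (f j)
  ; sym = λ i j → sym G (f i) (f j)
  ; irrfl = λ i → irrfl G (f i) }

IsInducedSubgraphOf : Graph → Graph → Set
IsInducedSubgraphOf H G =
  Σ (Fin (n H) → Fin (n G)) λ f →
    Injective _≡_ _≡_ f ×
    (∀ i j → adj H i j ≡ adj G (f i) (f j))

module _ (G : Graph) where

  IsStable : Subset (n G) → Set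
  IsStable S = ∀ i j → i ∈ S → j ∈ S → adj G i j ≡ false

  IsClique : Subset (n G) → Set
  IsClique S = ∀ i j → i ∈ S → j ∈ S → i ≢ j → adj G i j ≡ true

  IsProperColouring : (k : ℕ) → (Fin (n G) → Fin k) → Set
  IsProperColouring k c = ∀ i j → adj G i j ≡ true → c i ≢ c j

  IsCliqueNumber : ℕ → Set
  IsCliqueNumber w =
    (Σ (Subset (n G)) λ S → IsClique S × ∣ S ∣ ≡ w) ×
    (∀ S → IsClique S → ∣ S ∣ ≤ w)

  IsChromaticNumber : ℕ → Set
  IsChromaticNumber k =
    (Σ (Fin (n G) → Fin k) λ c → IsProperColouring k c) ×
    (∀ k' (c : Fin (n G) → Fin k') → IsProperColouring k' c → k ≤ k')

  IsMaximumStable : Subset (n G) → Set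
  IsMaximumStable S = IsStable S × (∀ T → IsStable T → ∣ T ∣ ≤ ∣ S ∣)

  Meets : Subset (n G) → Subset (n G) → Set
  Meets X S = ∃ λ v → v ∈ X × v ∈ S

  IsTransversal : Subset (n G) → Set
  IsTransversal X = ∀ S → IsMaximumStable S → Meets X S

  IsEta : ℕ → Set
  IsEta e =
    (Σ (Subset (n G)) λ X → IsTransversal X × ∣ X ∣ ≡ e) ×
    (∀ X → IsTransversal X → e ≤ ∣ X ∣)

Perfect : Graph → Set
Perfect G = ∀ (H : Graph) → IsInducedSubgraphOf H G →
  ∀ χ ω → IsChromaticNumber H χ → IsCliqueNumber H ω → χ ≤ ω

EtaBounded : Graph → Set
EtaBounded G = ∀ (H : Graph) → IsInducedSubgraphOf H G → 1 ≤ n H →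
  ∀ η ω → IsEta H η → IsCliqueNumber H ω → η ≤ ω

-- Both conditions are equivalent to Lovász's condition |U| ≤ α(G[U]) ω(G[U]) for all vertex sets U.
--
-- If every induced subgraph has a set X of at most ω vertices meeting all its maximum stable sets,
-- deleting X lowers α without raising ω, and induction on |U| gives |U| ≤ |X| + (α − 1)ω ≤ αω.
--
-- Lovász's condition implies that G[U] is ω-colourable (Gasparian's proof): take a maximum stable
-- set A₀ and, for each v ∈ A₀, the colour classes of an ω-colouring of U − v. If removing one of
-- these αω + 1 stable sets lowers ω, colour the rest by induction; otherwise ω-cliques avoiding
-- them make the Gram matrix of incidence vectors J − I, forcing αω + 1 independent vectors in ℤ^U.
--
-- The condition is symmetric in α and ω, so perfect graphs have perfect complements. A colour class
-- of an α-colouring of the complement of G[U] is then a clique of G meeting every maximum stable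
-- set, since such a set is an α-clique of the complement and uses every colour.

module Submission where

module Search where

  open import Data.Nat.Base using (ℕ; zero; suc; _≤_; _<_)
  open import Data.Nat.Properties using (≤-pred; ≤∧≢⇒<; ≮⇒≥; anyUpTo?)
  open import Data.Nat.Induction using (<-rec)
  open import Data.Bool.Base using (Bool; true; false)
  open import Data.Fin.Base using (Fin; zero; suc)
  open import Data.Fin.Properties using (any?)
  open import Data.Vec.Functional using (_∷_; tail)
  open import Data.Product.Base using (∃; _×_; _,_)
  open import Data.Sum.Base using (_⊎_; inj₁; inj₂)
  open import Function.Base using (_∘_)
  open import Relation.Nullary using (Dec; yes; no)
  open import Relation.Nullary.Decidable using (map′; _⊎-dec_)
  open import Relation.Binary.PropositionalEquality

  Searchable : Set → Set₁
  Searchable A = ∀ {P : A → Set} → (∀ a → Dec (P a)) → Dec (∃ P)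

  search-Bool : Searchable Bool
  search-Bool {P} P? = map′ from-⊎ to-⊎ (P? true ⊎-dec P? false)
    where
    from-⊎ : P true ⊎ P false → ∃ P
    from-⊎ (inj₁ p) = true , p
    from-⊎ (inj₂ p) = false , p
    to-⊎ : ∃ P → P true ⊎ P false
    to-⊎ (true  , p) = inj₁ p
    to-⊎ (false , p) = inj₂ p

  search-Fin : ∀ {k} → Searchable (Fin k)
  search-Fin P? = any? P?

  search-functions : ∀ {A} → Searchable A → ∀ {k} {Q : (Fin k → A) → Set} →
    (∀ {f g} → (∀ i → f i ≡ g i) → Q f → Q g) → (∀ f → Dec (Q f)) → Dec (∃ Q)
  search-functions {A} search-A {zero} resp Q? = map′ (empty ,_) (λ (f , q) → resp (λ ()) q) (Q? empty)
    where
    empty : Fin 0 → A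
    empty ()
  search-functions {A} search-A {suc k} resp Q? =
    map′ (λ (a , f , q) → a ∷ f , q)
         (λ (f , q) → f zero , tail f , resp (λ { zero → refl ; (suc i) → refl }) q)
         (search-A λ a → search-functions search-A (resp ∘ cons-cong a) (Q? ∘ (a ∷_)))
    where
    cons-cong : ∀ a {f g : Fin k → A} → (∀ i → f i ≡ g i) → ∀ i → (a ∷ f) i ≡ (a ∷ g) i
    cons-cong a f≗g zero    = refl
    cons-cong a f≗g (suc i) = f≗g i

  Least : (ℕ → Set) → ℕ → Set
  Least P k = P k × (∀ k′ → P k′ → k ≤ k′)

  Greatest : (ℕ → Set) → ℕ → Set
  Greatest P k = P k × (∀ k′ → P k′ → k′ ≤ k)

  least : ∀ {P : ℕ → Set} → (∀ k → Dec (P k)) → ∀ {k₀} → P k₀ → ∃ (Least P)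
  least {P} P? {k₀} = <-rec (λ k₀ → P k₀ → ∃ (Least P)) step k₀
    where
    step : ∀ k₀ → (∀ {k} → k < k₀ → P k → ∃ (Least P)) → P k₀ → ∃ (Least P)
    step k₀ rec Pk₀ with anyUpTo? P? k₀
    ... | yes (k , k<k₀ , Pk) = rec k<k₀ Pk
    ... | no  none            = k₀ , Pk₀ , λ k′ Pk′ → ≮⇒≥ (λ k′<k₀ → none (k′ , k′<k₀ , Pk′))

  greatest : ∀ {P : ℕ → Set} → (∀ k → Dec (P k)) → P 0 → ∀ B → (∀ k → P k → k ≤ B) → ∃ (Greatest P)
  greatest P? P0 zero    ≤B = 0 , P0 , ≤B
  greatest P? P0 (suc B) ≤B with P? (suc B)
  ... | yes PB = suc B , PB , ≤B
  ... | no ¬PB = greatest P? P0 B (λ k Pk → ≤-pred (≤∧≢⇒< (≤B k Pk) (λ { refl → ¬PB Pk })))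

module Sums where

  open import Data.Nat.Base using (ℕ; zero; suc; _+_; _*_; _≤_; z≤n)
  open import Data.Nat.Properties
  open import Data.Fin.Base using (Fin; zero; suc; punchIn; punchOut; _↑ˡ_; _↑ʳ_; combine)
  open import Data.Fin.Properties using (punchIn-punchOut)
  open import Function.Base using (_∘_)
  open import Relation.Binary.PropositionalEquality
  open import Algebra.Properties.Semiring.Sum +-*-semiring public
    using (sum; sum-cong-≗; ∑-distrib-+; ∑-comm; sum-remove)

  sum-const : ∀ n c → sum {n} (λ _ → c) ≡ n * c
  sum-const zero    c = refl
  sum-const (suc n) c = cong (c +_) (sum-const n c)

  sum-mono : ∀ {n} {f g : Fin n → ℕ} → (∀ i → f i ≤ g i) → sum f ≤ sum g
  sum-mono {zero}  f≤g = z≤n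
  sum-mono {suc n} f≤g = +-mono-≤ (f≤g zero) (sum-mono (f≤g ∘ suc))

  sum-++ : ∀ {m n} (f : Fin (m + n) → ℕ) →
    sum f ≡ sum (λ i → f (i ↑ˡ n)) + sum (λ j → f (m ↑ʳ j))
  sum-++ {zero}  f = refl
  sum-++ {suc m} f = trans (cong (f zero +_) (sum-++ {m} (f ∘ suc))) (sym (+-assoc (f zero) _ _))

  sum-combine : ∀ {a b} (f : Fin (a * b) → ℕ) → sum f ≡ sum (λ r → sum (λ t → f (combine {a} {b} r t)))
  sum-combine {zero}      f = refl
  sum-combine {suc a} {b} f = trans (sum-++ {b} {a * b} f)
    (cong (sum (λ t → f (t ↑ˡ (a * b))) +_) (sum-combine {a} {b} (f ∘ (b ↑ʳ_))))

  sum-saturated-head : ∀ {n} (f : Fin (suc n) → ℕ) → (∀ i → f i ≤ 1) → sum f ≡ suc n → f zero ≡ 1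
  sum-saturated-head {n} f f≤1 Σf≡ = ≤-antisym (f≤1 zero) (+-cancelʳ-≤ n 1 (f zero) (begin
    suc n                      ≡⟨ Σf≡ ⟨
    f zero + sum (f ∘ suc)     ≤⟨ +-monoʳ-≤ (f zero) (sum-mono (f≤1 ∘ suc)) ⟩
    f zero + sum {n} (λ _ → 1) ≡⟨ cong (f zero +_) (trans (sum-const n 1) (*-identityʳ n)) ⟩
    f zero + n                 ∎))
    where open ≤-Reasoning

  sum-saturated : ∀ {n} (f : Fin n → ℕ) → (∀ i → f i ≤ 1) → sum f ≡ n → ∀ i → f i ≡ 1
  sum-saturated         f f≤1 Σf≡ zero    = sum-saturated-head f f≤1 Σf≡
  sum-saturated {suc n} f f≤1 Σf≡ (suc i) = sum-saturated (f ∘ suc) (f≤1 ∘ suc) Σtail≡ i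
    where
    Σtail≡ : sum (f ∘ suc) ≡ n
    Σtail≡ = suc-injective (trans (cong (_+ sum (f ∘ suc)) (sym (sum-saturated-head f f≤1 Σf≡))) Σf≡)

  sum-saturated-except : ∀ {n} (f : Fin (suc n) → ℕ) j → (∀ i → f i ≤ 1) → f j ≡ 0 → sum f ≡ n →
    ∀ i → i ≢ j → f i ≡ 1
  sum-saturated-except {n} f j f≤1 fj≡0 Σf≡ i i≢j =
    trans (cong f (sym (punchIn-punchOut j≢i)))
      (sum-saturated (f ∘ punchIn j) (f≤1 ∘ punchIn j) Σrest≡ (punchOut j≢i))
    where
    j≢i : j ≢ i
    j≢i = i≢j ∘ sym
    Σrest≡ : sum (f ∘ punchIn j) ≡ n
    Σrest≡ = trans (cong (_+ sum (f ∘ punchIn j)) (sym fj≡0)) (trans (sym (sum-remove {i = j} f)) Σf≡)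

module FiniteSets where

  open import Data.Nat.Base using (ℕ; zero; suc; _+_; _*_; _≤_; _<_; z≤n; s≤s; _≡ᵇ_)
  open import Data.Nat.Properties
  open import Data.Nat.Induction using (<-wellFounded)
  open import Data.Bool.Base using (Bool; true; false; _∧_; not)
  open import Data.Bool.Properties using (∧-zeroʳ; ∧-identityʳ; ∧-inverseʳ; ¬-not; T-≡) renaming (_≟_ to _≟ᵇ_)
  open import Data.Fin.Base using (Fin; zero; suc; toℕ; punchIn)
  open import Data.Fin.Properties using (any?; all?; punchInᵢ≢i)
    renaming (_≟_ to _≟ᶠ_; suc-injective to sucᶠ-injective)
  open import Data.Product.Base using (∃; _×_; _,_)
  open import Function.Base using (_∘_)
  open import Function.Bundles using (Equivalence)
  open import Relation.Nullary using (Dec; does; yes; no; contradiction)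
  open import Relation.Nullary.Decidable using (dec-true; dec-false; _→-dec_; _×-dec_)
  open import Relation.Binary.PropositionalEquality
  open import Induction.WellFounded using (module All)
  import Relation.Binary.Construct.On as On
  open Sums public
  open Search using (search-functions; search-Bool; greatest)

  -- Vertex sets are Boolean predicates rather than Data.Fin.Subset vectors, so that sizes are sums.
  FSet : ℕ → Set
  FSet N = Fin N → Bool

  iverson : Bool → ℕ
  iverson true  = 1
  iverson false = 0

  size : ∀ {N} → FSet N → ℕ
  size S = sum (λ x → iverson (S x))

  infix  4 _⊆_
  infixl 7 _∩_
  infixl 6 _─_

  _⊆_ : ∀ {N} → FSet N → FSet N → Set
  S ⊆ T = ∀ x → S x ≡ true → T x ≡ true

  _∩_ : ∀ {N} → FSet N → FSet N → FSet N
  (S ∩ T) x = S x ∧ T x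

  _─_ : ∀ {N} → FSet N → FSet N → FSet N
  (S ─ T) x = S x ∧ not (T x)

  ∅ : ∀ {N} → FSet N
  ∅ _ = false

  full : ∀ {N} → FSet N
  full _ = true

  ⁅_⁆ : ∀ {N} → Fin N → FSet N
  ⁅ u ⁆ x = does (x ≟ᶠ u)

  fibre : ∀ {N} → (Fin N → ℕ) → ℕ → FSet N
  fibre c t x = c x ≡ᵇ t

  module _ {N} (S T : FSet N) {x : Fin N} where

    ∈∩⁺ : S x ≡ true → T x ≡ true → (S ∩ T) x ≡ true
    ∈∩⁺ x∈S x∈T rewrite x∈S = x∈T

    ∈∩⁻ˡ : (S ∩ T) x ≡ true → S x ≡ true
    ∈∩⁻ˡ x∈S∩T with S x
    ... | true = refl

    ∈∩⁻ʳ : (S ∩ T) x ≡ true → T x ≡ true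
    ∈∩⁻ʳ x∈S∩T with S x
    ... | true = x∈S∩T

    ∈─⁺ : S x ≡ true → T x ≡ false → (S ─ T) x ≡ true
    ∈─⁺ x∈S x∉T rewrite x∈S | x∉T = refl

    ∈─⁻ˡ : (S ─ T) x ≡ true → S x ≡ true
    ∈─⁻ˡ x∈S─T with S x
    ... | true = refl

    ∈─⁻ʳ : (S ─ T) x ≡ true → T x ≡ false
    ∈─⁻ʳ x∈S─T with S x | T x
    ... | true | false = refl

  ⊆-trans : ∀ {N} {S T V : FSet N} → S ⊆ T → T ⊆ V → S ⊆ V
  ⊆-trans S⊆T T⊆V x = T⊆V x ∘ S⊆T x

  p∩q⊆p : ∀ {N} (S T : FSet N) → S ∩ T ⊆ S
  p∩q⊆p S T x = ∈∩⁻ˡ S T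

  p∩q⊆q : ∀ {N} (S T : FSet N) → S ∩ T ⊆ T
  p∩q⊆q S T x = ∈∩⁻ʳ S T

  p─q⊆p : ∀ {N} (S T : FSet N) → S ─ T ⊆ S
  p─q⊆p S T x = ∈─⁻ˡ S T

  fibre⁺ : ∀ {N} (c : Fin N → ℕ) {x t} → c x ≡ t → fibre c t x ≡ true
  fibre⁺ c {x} {t} cx≡t = Equivalence.to T-≡ (≡⇒≡ᵇ (c x) t cx≡t)

  fibre⁻ : ∀ {N} (c : Fin N → ℕ) {x t} → fibre c t x ≡ true → c x ≡ t
  fibre⁻ c {x} {t} x∈fibre = ≡ᵇ⇒≡ (c x) t (Equivalence.from T-≡ x∈fibre)

  ∈⁅⁆⁻ : ∀ {N} (u x : Fin N) → ⁅ u ⁆ x ≡ true → x ≡ u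
  ∈⁅⁆⁻ u x x∈⁅u⁆ with x ≟ᶠ u
  ... | yes x≡u = x≡u

  ∉─⁅⁆ : ∀ {N} (S : FSet N) x → (S ─ ⁅ x ⁆) x ≡ false
  ∉─⁅⁆ S x rewrite dec-true (x ≟ᶠ x) refl = ∧-zeroʳ (S x)

  infix 4 _⊆?_

  _⊆?_ : ∀ {N} (S T : FSet N) → Dec (S ⊆ T)
  S ⊆? T = all? λ x → (S x ≟ᵇ true) →-dec (T x ≟ᵇ true)

  iverson≤1 : ∀ b → iverson b ≤ 1
  iverson≤1 true  = ≤-refl
  iverson≤1 false = z≤n

  iverson-∧ : ∀ a b → iverson (a ∧ b) ≡ iverson a * iverson b
  iverson-∧ true  b = sym (+-identityʳ (iverson b))
  iverson-∧ false b = refl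

  size-cong : ∀ {N} {S T : FSet N} → (∀ x → S x ≡ T x) → size S ≡ size T
  size-cong S≗T = sum-cong-≗ (cong iverson ∘ S≗T)

  size-mono : ∀ {N} {S T : FSet N} → S ⊆ T → size S ≤ size T
  size-mono S⊆T = sum-mono (λ x → iverson-mono (S⊆T x))
    where
    iverson-mono : ∀ {a b} → (a ≡ true → b ≡ true) → iverson a ≤ iverson b
    iverson-mono {false} _   = z≤n
    iverson-mono {true}  a⇒b rewrite a⇒b refl = ≤-refl

  size≤ : ∀ {N} (S : FSet N) → size S ≤ N
  size≤ {N} S = ≤-trans (sum-mono (iverson≤1 ∘ S)) (≤-reflexive (trans (sum-const N 1) (*-identityʳ N)))

  size-empty : ∀ {N} {S : FSet N} → (∀ x → S x ≡ false) → size S ≡ 0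
  size-empty {N} S≡∅ = trans (size-cong S≡∅) (trans (sum-const N 0) (*-zeroʳ N))

  size-∅ : ∀ {N} → size (∅ {N}) ≡ 0
  size-∅ {N} = size-empty {S = ∅ {N}} (λ _ → refl)

  size-split : ∀ {N} (S T : FSet N) → size S ≡ size (S ∩ T) + size (S ─ T)
  size-split S T =
    trans (sum-cong-≗ λ x → split (S x) (T x)) (∑-distrib-+ (iverson ∘ (S ∩ T)) (iverson ∘ (S ─ T)))
    where
    split : ∀ a b → iverson a ≡ iverson (a ∧ b) + iverson (a ∧ not b)
    split true  true  = refl
    split true  false = refl
    split false _     = refl

  size-remove : ∀ {N} (S : FSet N) x → size S ≡ iverson (S x) + size (S ─ ⁅ x ⁆)
  size-remove {suc N} S x = trans (sum-remove {i = x} (iverson ∘ S)) (cong (iverson (S x) +_) (sym rest))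
    where
    kept : ∀ j → (S ─ ⁅ x ⁆) (punchIn x j) ≡ S (punchIn x j)
    kept j rewrite dec-false (punchIn x j ≟ᶠ x) (punchInᵢ≢i x j) = ∧-identityʳ (S (punchIn x j))
    rest : size (S ─ ⁅ x ⁆) ≡ sum (iverson ∘ S ∘ punchIn x)
    rest = trans (sum-remove {i = x} (iverson ∘ (S ─ ⁅ x ⁆)))
                 (cong₂ _+_ (cong iverson (∉─⁅⁆ S x)) (sum-cong-≗ (cong iverson ∘ kept)))

  size>0 : ∀ {N} (S : FSet N) {x} → S x ≡ true → 0 < size S
  size>0 S {x} x∈S rewrite size-remove S x | x∈S = s≤s z≤n

  size>0⇒nonempty : ∀ {N} (S : FSet N) → 0 < size S → ∃ λ x → S x ≡ true
  size>0⇒nonempty S |S|>0 with any? (λ x → S x ≟ᵇ true)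
  ... | yes x∈S = x∈S
  ... | no  S≢∅ = contradiction (size-empty (λ x → ¬-not (λ x∈S → S≢∅ (x , x∈S)))) (>⇒≢ |S|>0)

  size-⊂ : ∀ {N} {W U : FSet N} {x} → W ⊆ U → U x ≡ true → W x ≡ false → size W < size U
  size-⊂ {W = W} {U} {x} W⊆U x∈U x∉W = begin-strict
    size W                      ≡⟨ size-cong W≗U∩W ⟩
    size (U ∩ W)                <⟨ m<m+n (size (U ∩ W)) (size>0 (U ─ W) x∈U─W) ⟩
    size (U ∩ W) + size (U ─ W) ≡⟨ size-split U W ⟨
    size U                      ∎
    where
    open ≤-Reasoning
    W≗U∩W : ∀ y → W y ≡ (U ∩ W) y
    W≗U∩W y with W y in y∈W
    ... | true  rewrite W⊆U y y∈W = refl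
    ... | false = sym (∧-zeroʳ (U y))
    x∈U─W : (U ─ W) x ≡ true
    x∈U─W rewrite x∈U | x∉W = refl

  size-⁅⁆ : ∀ {N} (u : Fin N) → size ⁅ u ⁆ ≡ 1
  size-⁅⁆ u rewrite size-remove ⁅ u ⁆ u | dec-true (u ≟ᶠ u) refl =
    cong suc (size-empty λ x → ∧-inverseʳ (does (x ≟ᶠ u)))

  size≤1 : ∀ {N} (S : FSet N) → (∀ x y → S x ≡ true → S y ≡ true → x ≡ y) → size S ≤ 1
  size≤1 {zero}  S _ = z≤n
  size≤1 {suc N} S unique with S zero in 0∈S
  ... | true  = ≤-reflexive (cong suc (size-empty tail-empty))
    where
    tail-empty : ∀ x → S (suc x) ≡ false
    tail-empty x with S (suc x) in x∈S
    ... | true  with () ← unique zero (suc x) 0∈S x∈S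
    ... | false = refl
  ... | false = size≤1 (S ∘ suc) (λ x y x∈S y∈S → sucᶠ-injective (unique (suc x) (suc y) x∈S y∈S))

  ∑-size-fibres : ∀ {N} (W : FSet N) (c : Fin N → ℕ) k → (∀ x → W x ≡ true → c x < k) →
    sum {k} (λ t → size (W ∩ fibre c (toℕ t))) ≡ size W
  ∑-size-fibres {N} W c k c<k =
    trans (∑-comm {k} {N} (λ t x → iverson ((W ∩ fibre c (toℕ t)) x))) (sum-cong-≗ one-fibre)
    where
    one-hot : ∀ {k} m → m < k → sum {k} (λ t → iverson (m ≡ᵇ toℕ t)) ≡ 1
    one-hot {suc k} zero    _         = cong suc (trans (sum-const k 0) (*-zeroʳ k))
    one-hot {suc k} (suc m) (s≤s m<k) = one-hot m m<k
    one-fibre : ∀ x → sum {k} (λ t → iverson (W x ∧ (c x ≡ᵇ toℕ t))) ≡ iverson (W x)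
    one-fibre x with W x in x∈W
    ... | true  = one-hot (c x) (c<k x x∈W)
    ... | false = trans (sum-const k 0) (*-zeroʳ k)

  size-induction : ∀ {N} (P : FSet N → Set) →
    (∀ U → (∀ {W} → size W < size U → P W) → P U) → ∀ U → P U
  size-induction P = All.wfRec (On.wellFounded size <-wellFounded) _ P

  size-full : ∀ {N} → size (full {N}) ≡ N
  size-full {N} = trans (sum-const N 1) (*-identityʳ N)

  module _ {N : ℕ} where

    record IsLargestIn (P : FSet N → Set) (U : FSet N) (w : ℕ) : Set where
      field
        witness      : FSet N
        satisfies    : P witness
        witness⊆U    : witness ⊆ U
        size-witness : size witness ≡ w
        maximum      : ∀ K → P K → K ⊆ U → size K ≤ w

    -- Opaque, so that conversion checking never unfolds the exhaustive search.
    opaque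
      largest-exists : ∀ {P} → (∀ S → Dec (P S)) → (∀ {S T} → (∀ x → S x ≡ T x) → P S → P T) → P ∅ →
        ∀ U → ∃ (IsLargestIn P U)
      largest-exists {P} P? P-resp P∅ U with greatest Q? (∅ , P∅ , (λ _ ()) , size-∅ {N}) N Q-bounded
        where
        Q : ℕ → Set
        Q k = ∃ λ K → P K × K ⊆ U × size K ≡ k
        Q? : ∀ k → Dec (Q k)
        Q? k = search-functions search-Bool
          (λ K≗K′ (PK , K⊆U , |K|≡k) → P-resp K≗K′ PK , (λ x x∈K′ → K⊆U x (trans (K≗K′ x) x∈K′)) ,
                                        trans (sym (size-cong K≗K′)) |K|≡k)
          (λ K → P? K ×-dec K ⊆? U ×-dec size K ≟ k)
        Q-bounded : ∀ k → Q k → k ≤ N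
        Q-bounded k (K , _ , _ , |K|≡k) = subst (_≤ N) |K|≡k (size≤ K)
      ... | w , (K , PK , K⊆U , |K|≡w) , maximal =
        w , record { witness = K ; satisfies = PK ; witness⊆U = K⊆U ; size-witness = |K|≡w
                   ; maximum = λ K′ PK′ K′⊆U → maximal (size K′) (K′ , PK′ , K′⊆U , refl) }

    largest-mono : ∀ {P W U w w′} → W ⊆ U → IsLargestIn P W w → IsLargestIn P U w′ → w ≤ w′
    largest-mono W⊆U largest-W largest-U = subst (_≤ _) size-witness
      (IsLargestIn.maximum largest-U witness satisfies (⊆-trans witness⊆U W⊆U))
      where open IsLargestIn largest-W

    largest>0 : ∀ {P U w u} → (∀ u → P ⁅ u ⁆) → U u ≡ true → IsLargestIn P U w → 0 < w
    largest>0 {U = U} {u = u} P-⁅⁆ u∈U largest-U = subst (_≤ _) (size-⁅⁆ u)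
      (IsLargestIn.maximum largest-U ⁅ u ⁆ (P-⁅⁆ u) ⁅u⁆⊆U)
      where
      ⁅u⁆⊆U : ⁅ u ⁆ ⊆ U
      ⁅u⁆⊆U x x∈⁅u⁆ with refl ← ∈⁅⁆⁻ u x x∈⁅u⁆ = u∈U

    largest-resp : ∀ {P Q U w} → (∀ S → P S → Q S) → (∀ S → Q S → P S) →
      IsLargestIn P U w → IsLargestIn Q U w
    largest-resp P⇒Q Q⇒P largest-P = record
      { witness = witness ; satisfies = P⇒Q witness satisfies ; witness⊆U = witness⊆U
      ; size-witness = size-witness ; maximum = λ K QK → maximum K (Q⇒P K QK) }
      where open IsLargestIn largest-P

    largest<⇒size< : ∀ {P W U w′ w} → W ⊆ U → IsLargestIn P W w′ → IsLargestIn P U w → w′ < w →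
      size W < size U
    largest<⇒size< {W = W} {U} W⊆U largest-W largest-U w′<w
      with any? (λ x → (witness x ≟ᵇ true) ×-dec (W x ≟ᵇ false))
      where open IsLargestIn largest-U
    ... | yes (x , x∈K , x∉W) = size-⊂ W⊆U (IsLargestIn.witness⊆U largest-U x x∈K) x∉W
    ... | no  K⊈W = contradiction (IsLargestIn.maximum largest-W witness satisfies K⊆W)
                                  (<⇒≱ (subst (_ <_) (sym size-witness) w′<w))
      where
      open IsLargestIn largest-U
      K⊆W : witness ⊆ W
      K⊆W x x∈K = ¬-not λ x∉W → K⊈W (x , x∈K , x∉W)

module Enumeration where

  open import Data.Nat.Base using (ℕ; zero; suc; _+_; _*_)
  open import Data.Nat.Properties using (+-identityʳ)
  open import Data.Bool.Base using (Bool; true; false)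
  open import Data.Fin.Base using (Fin; zero; suc)
  open import Data.Fin.Properties using () renaming (suc-injective to sucᶠ-injective)
  open import Function.Base using (_∘_)
  open import Function.Definitions using (Injective)
  open import Relation.Binary.PropositionalEquality
  open FiniteSets

  mutual
    enum : ∀ {N} (U : FSet N) → Fin (size U) → Fin N
    enum {suc N} U = enum-cons (U zero) (U ∘ suc)

    enum-cons : ∀ {N} (b : Bool) (U : FSet N) → Fin (iverson b + size U) → Fin (suc N)
    enum-cons true  U zero    = zero
    enum-cons true  U (suc i) = suc (enum U i)
    enum-cons false U i       = suc (enum U i)

  mutual
    enum-∈ : ∀ {N} (U : FSet N) i → U (enum U i) ≡ true
    enum-∈ {suc N} U = enum-cons-∈ (U zero) U refl

    enum-cons-∈ : ∀ {N} b (U : FSet (suc N)) → U zero ≡ b → ∀ i → U (enum-cons b (U ∘ suc) i) ≡ true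
    enum-cons-∈ true  U 0∈U zero    = 0∈U
    enum-cons-∈ true  U _   (suc i) = enum-∈ (U ∘ suc) i
    enum-cons-∈ false U _   i       = enum-∈ (U ∘ suc) i

  mutual
    enum-injective : ∀ {N} (U : FSet N) → Injective _≡_ _≡_ (enum U)
    enum-injective {suc N} U = enum-cons-injective (U zero) (U ∘ suc)

    enum-cons-injective : ∀ {N} b (U : FSet N) → Injective _≡_ _≡_ (enum-cons b U)
    enum-cons-injective true  U {zero}  {zero}  _  = refl
    enum-cons-injective true  U {suc i} {suc j} eq = cong suc (enum-injective U (sucᶠ-injective eq))
    enum-cons-injective false U                 eq = enum-injective U (sucᶠ-injective eq)

  mutual
    ∑-enum : ∀ {N} (U : FSet N) (g : Fin N → ℕ) → sum (g ∘ enum U) ≡ sum (λ x → iverson (U x) * g x)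
    ∑-enum {zero}  U g = refl
    ∑-enum {suc N} U g = ∑-enum-cons (U zero) (U ∘ suc) g

    ∑-enum-cons : ∀ {N} b (U : FSet N) (g : Fin (suc N) → ℕ) →
      sum (g ∘ enum-cons b U) ≡ iverson b * g zero + sum (λ x → iverson (U x) * g (suc x))
    ∑-enum-cons true  U g = cong₂ _+_ (sym (+-identityʳ (g zero))) (∑-enum U (g ∘ suc))
    ∑-enum-cons false U g = ∑-enum U (g ∘ suc)

module LinearAlgebra where

  open import Data.Nat.Base using (ℕ; zero; suc; _≤_; _<_)
  import Data.Nat.Properties as ℕₚ
  open import Data.Integer.Base using (ℤ; +_; 0ℤ; 1ℤ; _+_; _*_; -_; _-_)
  open import Data.Integer.Properties
  open import Data.Integer.Solver using (module +-*-Solver)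
  open import Data.Bool.Base using (true; false; _∧_)
  open import Data.Fin.Base using (Fin; zero; suc; punchIn)
  open import Data.Fin.Properties using (all?; ¬∀⟶∃¬; punchInᵢ≢i)
  open import Data.Vec.Functional using (insertAt)
  open import Data.Vec.Functional.Properties using (insertAt-lookup; insertAt-punchIn)
  open import Data.Product.Base using (∃; _×_; _,_)
  open import Data.Sum.Base using (inj₁; inj₂)
  open import Function.Base using (_∘_)
  open import Relation.Nullary using (¬_; yes; no; contradiction)
  open import Relation.Binary.PropositionalEquality
  open import Algebra.Properties.Semiring.Sum +-*-semiring
    using (sum; sum-cong-≗; ∑-comm; sum-remove; *-distribˡ-sum; *-distribʳ-sum; sum-replicate-zero)
  open FiniteSets using (FSet; size; iverson; _∩_) renaming (sum to sumℕ)
  open +-*-Solver using (solve; _:+_; _:*_; :-_; _:-_; _:=_; con)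

  infix 7 _·_

  _·_ : ∀ {N} → (Fin N → ℤ) → (Fin N → ℤ) → ℤ
  u · v = sum (λ x → u x * v x)

  LinearlyDependent : ∀ {m N} → (Fin m → Fin N → ℤ) → Set
  LinearlyDependent {m} v =
    ∃ λ (c : Fin m → ℤ) → (∃ λ i → c i ≢ 0ℤ) × (∀ x → sum (λ i → c i * v i x) ≡ 0ℤ)

  indicator : ∀ {N} → FSet N → Fin N → ℤ
  indicator S x = + iverson (S x)

  sum-zero : ∀ {n} {f : Fin n → ℤ} → (∀ i → f i ≡ 0ℤ) → sum f ≡ 0ℤ
  sum-zero {n} f≡0 = trans (sum-cong-≗ f≡0) (sum-replicate-zero n)

  sum-const : ∀ n a → sum {n} (λ _ → a) ≡ + n * a
  sum-const zero    a = refl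
  sum-const (suc n) a = trans (cong (λ s → a + s) (sum-const n a))
    (sym (trans (*-distribʳ-+ a 1ℤ (+ n)) (cong (_+ + n * a) (*-identityˡ a))))

  sum-toℤ : ∀ {n} (f : Fin n → ℕ) → sum (λ i → + f i) ≡ + sumℕ f
  sum-toℤ {zero}  f = refl
  sum-toℤ {suc n} f = cong (λ s → + f zero + s) (sum-toℤ (f ∘ suc))

  indicator-· : ∀ {N} (S T : FSet N) → indicator S · indicator T ≡ + size (S ∩ T)
  indicator-· S T = trans (sum-cong-≗ λ x → product (S x) (T x)) (sum-toℤ (iverson ∘ (S ∩ T)))
    where
    product : ∀ a b → + iverson a * + iverson b ≡ + iverson (a ∧ b)
    product true  true  = refl
    product true  false = refl
    product false true  = refl
    product false false = refl

  sum-linear : ∀ {n} (c a b : Fin n → ℤ) p q →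
    sum (λ j → c j * (p * a j - b j * q)) ≡ p * sum (λ j → c j * a j) - sum (λ j → c j * b j) * q
  sum-linear {zero}  c a b p q = solve 2 (λ p q → con 0ℤ := p :* con 0ℤ :- con 0ℤ :* q) refl p q
  sum-linear {suc n} c a b p q rewrite sum-linear (c ∘ suc) (a ∘ suc) (b ∘ suc) p q =
    solve 7 (λ c₀ a₀ b₀ p q Σa Σb →
        c₀ :* (p :* a₀ :- b₀ :* q) :+ (p :* Σa :- Σb :* q) := p :* (c₀ :* a₀ :+ Σa) :- (c₀ :* b₀ :+ Σb) :* q)
      refl (c zero) (a zero) (b zero) p q
      (sum (λ j → c (suc j) * a (suc j))) (sum (λ j → c (suc j) * b (suc j)))

  dependent-tail : ∀ {m N} (v : Fin m → Fin (suc N) → ℤ) → (∀ i → v i zero ≡ 0ℤ) →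
    LinearlyDependent (λ i x → v i (suc x)) → LinearlyDependent v
  dependent-tail v v₀≡0 (c , c≢0 , relation) = c , c≢0 , λ
    { zero    → sum-zero (λ i → trans (cong (c i *_) (v₀≡0 i)) (*-zeroʳ (c i)))
    ; (suc x) → relation x }

  pivot-eliminate : ∀ {m N} → (Fin (suc m) → Fin (suc N) → ℤ) → Fin (suc m) → Fin m → Fin N → ℤ
  pivot-eliminate v k j x = v k zero * v (punchIn k j) (suc x) - v (punchIn k j) zero * v k (suc x)

  dependent-pivot : ∀ {m N} (v : Fin (suc m) → Fin (suc N) → ℤ) k → v k zero ≢ 0ℤ →
    LinearlyDependent (pivot-eliminate v k) → LinearlyDependent v
  dependent-pivot {m} {N} v k p≢0 (c , (j₀ , cj₀≢0) , relation) = d , (punchIn k j₀ , dj₀≢0) , d-relation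
    where
    p : ℤ
    p = v k zero
    s : Fin (suc N) → ℤ
    s x = sum (λ j → c j * v (punchIn k j) x)
    d : Fin (suc m) → ℤ
    d = insertAt (λ j → p * c j) k (- s zero)
    dj₀≢0 : d (punchIn k j₀) ≢ 0ℤ
    dj₀≢0 eq with i*j≡0⇒i≡0∨j≡0 p (trans (sym (insertAt-punchIn _ k _ j₀)) eq)
    ... | inj₁ p≡0   = p≢0 p≡0
    ... | inj₂ cj₀≡0 = cj₀≢0 cj₀≡0
    split : ∀ x → sum (λ i → d i * v i x) ≡ - s zero * v k x + p * s x
    split x = trans (sum-remove {i = k} (λ i → d i * v i x)) (cong₂ _+_
      (cong (_* v k x) (insertAt-lookup _ k _))
      (trans (sum-cong-≗ λ j → trans (cong (_* v (punchIn k j) x) (insertAt-punchIn _ k _ j))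
                                      (*-assoc p (c j) _))
             (sym (*-distribˡ-sum p (λ j → c j * v (punchIn k j) x)))))
    d-relation : ∀ x → sum (λ i → d i * v i x) ≡ 0ℤ
    d-relation zero    = trans (split zero) (solve 2 (λ p s → :- s :* p :+ p :* s := con 0ℤ) refl p (s zero))
    d-relation (suc x) = begin
      sum (λ i → d i * v i (suc x))
        ≡⟨ split (suc x) ⟩
      - s zero * v k (suc x) + p * s (suc x)
        ≡⟨ solve 4 (λ p s₀ q sₓ → :- s₀ :* q :+ p :* sₓ := p :* sₓ :- s₀ :* q)
                 refl p (s zero) (v k (suc x)) (s (suc x)) ⟩
      p * s (suc x) - s zero * v k (suc x)
        ≡⟨ sum-linear c (λ j → v (punchIn k j) (suc x)) (λ j → v (punchIn k j) zero) p (v k (suc x)) ⟨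
      sum (λ j → c j * pivot-eliminate v k j x)
        ≡⟨ relation x ⟩
      0ℤ ∎
      where open ≡-Reasoning

  supported-dependent : ∀ {N m} (U : FSet N) (v : Fin m → Fin N → ℤ) →
    (∀ i x → U x ≡ false → v i x ≡ 0ℤ) → size U < m → LinearlyDependent v
  supported-dependent {zero}  {suc m} U v _ _ = (λ _ → 1ℤ) , (zero , λ ()) , λ ()
  supported-dependent {suc N} {suc m} U v outside≡0 |U|<m with all? (λ k → v k zero ≟ 0ℤ)
  ... | yes v₀≡0 = dependent-tail v v₀≡0
    (supported-dependent (U ∘ suc) (λ i x → v i (suc x)) (λ i x → outside≡0 i (suc x))
      (ℕₚ.≤-<-trans (ℕₚ.m≤n+m _ (iverson (U zero))) |U|<m))
  ... | no ¬v₀≡0 with k , p≢0 ← ¬∀⟶∃¬ _ _ (λ k → v k zero ≟ 0ℤ) ¬v₀≡0 =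
    dependent-pivot v k p≢0
      (supported-dependent (U ∘ suc) (pivot-eliminate v k) outside≡0′
        (ℕₚ.≤-pred (subst (_< suc m) |U|≡ |U|<m)))
    where
    0∈U : U zero ≡ true
    0∈U with U zero in eq
    ... | true  = refl
    ... | false = contradiction (outside≡0 k zero eq) p≢0
    |U|≡ : size U ≡ suc (size (U ∘ suc))
    |U|≡ rewrite 0∈U = refl
    outside≡0′ : ∀ j x → U (suc x) ≡ false → pivot-eliminate v k j x ≡ 0ℤ
    outside≡0′ j x x∉U rewrite outside≡0 (punchIn k j) (suc x) x∉U | outside≡0 k (suc x) x∉U =
      solve 2 (λ a b → a :* con 0ℤ :- b :* con 0ℤ := con 0ℤ) refl (v k zero) (v (punchIn k j) zero)

  J-I-gram⇒independent : ∀ {M N} → 1 ≤ M → (a b : Fin (suc M) → Fin N → ℤ) →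
    (∀ j → a j · b j ≡ 0ℤ) → (∀ i j → i ≢ j → a i · b j ≡ 1ℤ) → ¬ LinearlyDependent a
  J-I-gram⇒independent {M} 1≤M a b diagonal off-diagonal (c , (i₀ , ci₀≢0) , relation) =
    ci₀≢0 (trans (all-equal i₀) T≡0)
    where
    T : ℤ
    T = sum c
    orthogonal : ∀ j → sum (λ i → c i * (a i · b j)) ≡ 0ℤ
    orthogonal j = begin
      sum (λ i → c i * (a i · b j))
        ≡⟨ sum-cong-≗ (λ i → *-distribˡ-sum (c i) (λ x → a i x * b j x)) ⟩
      sum (λ i → sum (λ x → c i * (a i x * b j x)))
        ≡⟨ ∑-comm (λ i x → c i * (a i x * b j x)) ⟩
      sum (λ x → sum (λ i → c i * (a i x * b j x)))
        ≡⟨ sum-cong-≗ regroup ⟩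
      sum (λ x → sum (λ i → c i * a i x) * b j x)
        ≡⟨ sum-zero (λ x → trans (cong (_* b j x) (relation x)) (*-zeroˡ (b j x))) ⟩
      0ℤ ∎
      where
      open ≡-Reasoning
      regroup : ∀ x → sum (λ i → c i * (a i x * b j x)) ≡ sum (λ i → c i * a i x) * b j x
      regroup x = trans (sum-cong-≗ λ i → sym (*-assoc (c i) (a i x) (b j x)))
                        (sym (*-distribʳ-sum (b j x) (λ i → c i * a i x)))
    others-vanish : ∀ j → sum (c ∘ punchIn j) ≡ 0ℤ
    others-vanish j = begin
      sum (c ∘ punchIn j)                     ≡⟨ sum-cong-≗ off-diagonal-term ⟨
      sum (weighted ∘ punchIn j)              ≡⟨ +-identityˡ _ ⟨
      0ℤ + sum (weighted ∘ punchIn j)         ≡⟨ cong (_+ sum (weighted ∘ punchIn j)) diagonal-term ⟨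
      weighted j + sum (weighted ∘ punchIn j) ≡⟨ sum-remove {i = j} weighted ⟨
      sum weighted                            ≡⟨ orthogonal j ⟩
      0ℤ                                      ∎
      where
      open ≡-Reasoning
      weighted : Fin (suc M) → ℤ
      weighted i = c i * (a i · b j)
      diagonal-term : weighted j ≡ 0ℤ
      diagonal-term = trans (cong (c j *_) (diagonal j)) (*-zeroʳ (c j))
      off-diagonal-term : ∀ l → weighted (punchIn j l) ≡ c (punchIn j l)
      off-diagonal-term l = trans (cong (c (punchIn j l) *_) (off-diagonal _ j (punchInᵢ≢i j l)))
                                  (*-identityʳ (c (punchIn j l)))
    all-equal : ∀ j → c j ≡ T
    all-equal j = begin
      c j                       ≡⟨ +-identityʳ (c j) ⟨
      c j + 0ℤ                  ≡⟨ cong (λ z → c j + z) (others-vanish j) ⟨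
      c j + sum (c ∘ punchIn j) ≡⟨ sum-remove {i = j} c ⟨
      T                         ∎
      where open ≡-Reasoning
    M*T≡0 : + M * T ≡ 0ℤ
    M*T≡0 = begin
      + M * T                 ≡⟨ solve 2 (λ m t → m :* t := (con 1ℤ :+ m) :* t :- t) refl (+ M) T ⟩
      + suc M * T - T         ≡⟨ cong (_- T) (trans (sum-cong-≗ all-equal) (sum-const (suc M) T)) ⟨
      T - T                   ≡⟨ +-inverseʳ T ⟩
      0ℤ                      ∎
      where open ≡-Reasoning
    T≡0 : T ≡ 0ℤ
    T≡0 with i*j≡0⇒i≡0∨j≡0 (+ M) M*T≡0
    ... | inj₁ M≡0 = contradiction 1≤M (ℕₚ.<-irrefl (sym (+-injective M≡0)))
    ... | inj₂ T≡0 = T≡0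

module Graphs where

  open import Defs using (Graph; n; adj; irrfl) renaming (sym to adj-sym)
  open import Data.Nat.Base using (ℕ; suc; _+_; _*_; _≤_; _<_)
  open import Data.Nat.Properties
  open import Data.Bool.Base using (Bool; true; false; if_then_else_)
  open import Data.Bool.Properties using () renaming (_≟_ to _≟ᵇ_)
  open import Data.Fin.Base using (Fin; toℕ)
  open import Data.Fin.Properties using (all?) renaming (_≟_ to _≟ᶠ_)
  open import Data.Product.Base using (∃; _×_; _,_)
  open import Relation.Nullary using (Dec; ¬?; contradiction)
  open import Relation.Nullary.Decidable using (_→-dec_; decidable-stable)
  open import Relation.Binary.PropositionalEquality
  open FiniteSets

  module _ (G : Graph) where

    Vertex : Set
    Vertex = Fin (n G)

    Stable : FSet (n G) → Set
    Stable S = ∀ x y → S x ≡ true → S y ≡ true → adj G x y ≡ false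

    Clique : FSet (n G) → Set
    Clique S = ∀ x y → S x ≡ true → S y ≡ true → x ≢ y → adj G x y ≡ true

    IsOmega : FSet (n G) → ℕ → Set
    IsOmega = IsLargestIn Clique

    IsAlpha : FSet (n G) → ℕ → Set
    IsAlpha = IsLargestIn Stable

    record Colouring (U : FSet (n G)) (k : ℕ) : Set where
      field
        colour  : Vertex → ℕ
        bounded : ∀ x → U x ≡ true → colour x < k
        proper  : ∀ x y → U x ≡ true → U y ≡ true → adj G x y ≡ true → colour x ≢ colour y

    BoundedByαω : Set
    BoundedByαω = ∀ U a w → IsAlpha U a → IsOmega U w → size U ≤ a * w

    stable? : ∀ S → Dec (Stable S)
    stable? S = all? λ x → all? λ y → (S x ≟ᵇ true) →-dec (S y ≟ᵇ true) →-dec (adj G x y ≟ᵇ false)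

    clique? : ∀ S → Dec (Clique S)
    clique? S = all? λ x → all? λ y →
      (S x ≟ᵇ true) →-dec (S y ≟ᵇ true) →-dec (¬? (x ≟ᶠ y)) →-dec (adj G x y ≟ᵇ true)

    stable-resp : ∀ {S T} → (∀ x → S x ≡ T x) → Stable S → Stable T
    stable-resp S≗T S-stable x y x∈T y∈T = S-stable x y (trans (S≗T x) x∈T) (trans (S≗T y) y∈T)

    clique-resp : ∀ {S T} → (∀ x → S x ≡ T x) → Clique S → Clique T
    clique-resp S≗T S-clique x y x∈T y∈T = S-clique x y (trans (S≗T x) x∈T) (trans (S≗T y) y∈T)

    stable-⁅⁆ : ∀ u → Stable ⁅ u ⁆
    stable-⁅⁆ u x y x∈⁅u⁆ y∈⁅u⁆ with refl ← ∈⁅⁆⁻ u x x∈⁅u⁆ | refl ← ∈⁅⁆⁻ u y y∈⁅u⁆ = irrfl G u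

    clique-⁅⁆ : ∀ u → Clique ⁅ u ⁆
    clique-⁅⁆ u x y x∈⁅u⁆ y∈⁅u⁆ x≢y = contradiction (trans (∈⁅⁆⁻ u x x∈⁅u⁆) (sym (∈⁅⁆⁻ u y y∈⁅u⁆))) x≢y

    ω-exists : ∀ U → ∃ (IsOmega U)
    ω-exists = largest-exists clique? clique-resp (λ _ _ ())

    α-exists : ∀ U → ∃ (IsAlpha U)
    α-exists = largest-exists stable? stable-resp (λ _ _ ())

    stable∩clique≤1 : ∀ {S K} → Stable S → Clique K → size (S ∩ K) ≤ 1
    stable∩clique≤1 {S} {K} S-stable K-clique = size≤1 (S ∩ K) unique
      where
      unique : ∀ x y → (S ∩ K) x ≡ true → (S ∩ K) y ≡ true → x ≡ y
      unique x y x∈ y∈ = decidable-stable (x ≟ᶠ y) λ x≢y → contradiction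
        (trans (sym (S-stable x y (∈∩⁻ˡ S K x∈) (∈∩⁻ˡ S K y∈))) (K-clique x y (∈∩⁻ʳ S K x∈) (∈∩⁻ʳ S K y∈) x≢y))
        λ ()

    colouring-empty : ∀ {U} k → (∀ x → U x ≡ false) → Colouring U k
    colouring-empty k U≡∅ = record
      { colour = λ _ → 0
      ; bounded = λ x x∈U → contradiction (trans (sym x∈U) (U≡∅ x)) λ ()
      ; proper = λ x y x∈U → contradiction (trans (sym x∈U) (U≡∅ x)) λ () }

    colouring-weaken : ∀ {U k k′} → k ≤ k′ → Colouring U k → Colouring U k′
    colouring-weaken k≤k′ c = record
      { colour = colour ; bounded = λ x x∈U → <-≤-trans (bounded x x∈U) k≤k′ ; proper = proper }
      where open Colouring c

    fibre-stable : ∀ {U k} (c : Colouring U k) t → Stable (U ∩ fibre (Colouring.colour c) t)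
    fibre-stable {U} c t x y x∈ y∈ with adj G x y in xy
    ... | false = refl
    ... | true  = contradiction (trans (fibre⁻ colour (∈∩⁻ʳ U F x∈)) (sym (fibre⁻ colour (∈∩⁻ʳ U F y∈))))
                                (proper x y (∈∩⁻ˡ U F x∈) (∈∩⁻ˡ U F y∈) xy)
      where
      open Colouring c
      F : FSet (n G)
      F = fibre colour t

    colouring-extend : ∀ {U A k} → Stable A → Colouring (U ─ A) k → Colouring U (suc k)
    colouring-extend {U} {A} {k} A-stable c =
      record { colour = colour′ ; bounded = bounded′ ; proper = proper′ }
      where
      open Colouring c
      colour′ : Vertex → ℕ
      colour′ x = if A x then k else colour x
      bounded′ : ∀ x → U x ≡ true → colour′ x < suc k
      bounded′ x x∈U with A x in x∈A
      ... | true  = ≤-refl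
      ... | false = m≤n⇒m≤1+n (bounded x (∈─⁺ U A x∈U x∈A))
      proper′ : ∀ x y → U x ≡ true → U y ≡ true → adj G x y ≡ true → colour′ x ≢ colour′ y
      proper′ x y x∈U y∈U xy with A x in x∈A | A y in y∈A
      ... | true  | true  = contradiction (trans (sym (A-stable x y x∈A y∈A)) xy) λ ()
      ... | true  | false = ≢-sym (<⇒≢ (bounded y (∈─⁺ U A y∈U y∈A)))
      ... | false | true  = <⇒≢ (bounded x (∈─⁺ U A x∈U x∈A))
      ... | false | false = proper x y (∈─⁺ U A x∈U x∈A) (∈─⁺ U A y∈U y∈A) xy

    size≤colours*α : ∀ {U k a} → Colouring U k → IsAlpha U a → size U ≤ k * a
    size≤colours*α {U} {k} {a} c α-U = begin
      size U                                             ≡⟨ ∑-size-fibres U colour k bounded ⟨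
      sum {k} (λ t → size (U ∩ fibre colour (toℕ t)))    ≤⟨ sum-mono {k} fibre≤α ⟩
      sum {k} (λ _ → a)                                  ≡⟨ sum-const k a ⟩
      k * a                                              ∎
      where
      open ≤-Reasoning
      open Colouring c
      fibre≤α : ∀ t → size (U ∩ fibre colour (toℕ t)) ≤ a
      fibre≤α t = IsLargestIn.maximum α-U (U ∩ fibre colour (toℕ t)) (fibre-stable c (toℕ t))
                                      (p∩q⊆p U (fibre colour (toℕ t)))

    clique-meets-fibres : ∀ {U K k} (c : Colouring U k) → Clique K → K ⊆ U → size K ≡ k →
      ∀ (t : Fin k) → ∃ λ x → K x ≡ true × Colouring.colour c x ≡ toℕ t
    clique-meets-fibres {U} {K} {k} c K-clique K⊆U |K|≡k t
      with size>0⇒nonempty (K ∩ fibre (Colouring.colour c) (toℕ t))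
                           (≤-reflexive (sym (sum-saturated part part≤1 Σpart≡k t)))
      where
      open Colouring c
      part : Fin k → ℕ
      part t = size (K ∩ fibre colour (toℕ t))
      part≤1 : ∀ t → part t ≤ 1
      part≤1 t = size≤1 (K ∩ F) λ x y x∈ y∈ → decidable-stable (x ≟ᶠ y) λ x≢y → proper x y
        (K⊆U x (∈∩⁻ˡ K F x∈)) (K⊆U y (∈∩⁻ˡ K F y∈)) (K-clique x y (∈∩⁻ˡ K F x∈) (∈∩⁻ˡ K F y∈) x≢y)
        (trans (fibre⁻ colour (∈∩⁻ʳ K F x∈)) (sym (fibre⁻ colour (∈∩⁻ʳ K F y∈))))
        where
        F : FSet (n G)
        F = fibre colour (toℕ t)
      Σpart≡k : sum part ≡ k
      Σpart≡k = trans (∑-size-fibres K colour k (λ x x∈K → bounded x (K⊆U x x∈K))) |K|≡k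
    ... | x , x∈ = x , ∈∩⁻ˡ K F x∈ , fibre⁻ (Colouring.colour c) (∈∩⁻ʳ K F x∈)
      where
      F : FSet (n G)
      F = fibre (Colouring.colour c) (toℕ t)

module Complement where

  open import Defs using (Graph; n; adj; irrfl) renaming (sym to adj-sym)
  open import Data.Nat.Base using (_*_; _≤_)
  open import Data.Nat.Properties
  open import Data.Bool.Base using (_∧_; not)
  open import Data.Bool.Properties using (not-injective)
  open import Data.Fin.Properties using () renaming (_≟_ to _≟ᶠ_)
  open import Relation.Nullary using (yes; no; contradiction; does)
  open import Relation.Nullary.Decidable using (dec-true; dec-false)
  open import Relation.Binary.PropositionalEquality
  open FiniteSets
  open Graphs

  complement : Graph → Graph
  complement G = record
    { n     = n G
    ; adj   = λ x y → not (does (x ≟ᶠ y)) ∧ not (adj G x y)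
    ; sym   = λ x y → cong₂ (λ a b → not a ∧ not b) (≟-sym x y) (adj-sym G x y)
    ; irrfl = λ x → cong (λ a → not a ∧ not (adj G x x)) (dec-true (x ≟ᶠ x) refl) }
    where
    ≟-sym : ∀ x y → does (x ≟ᶠ y) ≡ does (y ≟ᶠ x)
    ≟-sym x y with x ≟ᶠ y | y ≟ᶠ x
    ... | yes _   | yes _   = refl
    ... | no  _   | no  _   = refl
    ... | yes x≡y | no  y≢x = contradiction (sym x≡y) y≢x
    ... | no  x≢y | yes y≡x = contradiction (sym y≡x) x≢y

  module _ (G : Graph) where

    complement-adj : ∀ {x y} → x ≢ y → adj (complement G) x y ≡ not (adj G x y)
    complement-adj {x} {y} x≢y rewrite dec-false (x ≟ᶠ y) x≢y = refl

    stable⇒complement-clique : ∀ {S} → Stable G S → Clique (complement G) S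
    stable⇒complement-clique S-stable x y x∈S y∈S x≢y =
      trans (complement-adj x≢y) (cong not (S-stable x y x∈S y∈S))

    clique⇒complement-stable : ∀ {S} → Clique G S → Stable (complement G) S
    clique⇒complement-stable S-clique x y x∈S y∈S with x ≟ᶠ y
    ... | yes refl = refl
    ... | no  x≢y  = cong not (S-clique x y x∈S y∈S x≢y)

    complement-stable⇒clique : ∀ {S} → Stable (complement G) S → Clique G S
    complement-stable⇒clique S-stable x y x∈S y∈S x≢y =
      not-injective (trans (sym (complement-adj x≢y)) (S-stable x y x∈S y∈S))

    complement-clique⇒stable : ∀ {S} → Clique (complement G) S → Stable G S
    complement-clique⇒stable S-clique x y x∈S y∈S with x ≟ᶠ y
    ... | yes refl = irrfl G x
    ... | no  x≢y  = not-injective (trans (sym (complement-adj x≢y)) (S-clique x y x∈S y∈S x≢y))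

    complement-ω : ∀ {U a} → IsAlpha G U a → IsOmega (complement G) U a
    complement-ω = largest-resp (λ _ → stable⇒complement-clique) (λ _ → complement-clique⇒stable)

    complement-bounded : BoundedByαω G → BoundedByαω (complement G)
    complement-bounded bound U w a α-U ω-U = subst (size U ≤_) (*-comm a w)
      (bound U a w (largest-resp (λ _ → complement-clique⇒stable) (λ _ → stable⇒complement-clique) ω-U)
                   (largest-resp (λ _ → complement-stable⇒clique) (λ _ → clique⇒complement-stable) α-U))

module Lovász where

  open import Defs using (Graph; n)
  open import Data.Nat.Base using (ℕ; zero; suc; _+_; _*_; _≤_; _<_; s≤s)
  open import Data.Nat.Properties
  open import Data.Integer.Base using (+_)
  open import Data.Bool.Base using (true; false; _∧_)
  open import Data.Bool.Properties using (∧-assoc; ∧-comm; ∧-zeroʳ; ∧-identityʳ; ¬-not) renaming (_≟_ to _≟ᵇ_)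
  open import Data.Fin.Base using (Fin; zero; suc; toℕ; combine; remQuot)
  open import Data.Fin.Properties using (any?; remQuot-combine)
  open import Data.Product.Base using (_,_; proj₁; proj₂; uncurry)
  open import Data.Empty using (⊥; ⊥-elim)
  open import Function.Base using (_∘_)
  open import Relation.Nullary using (yes; no; contradiction)
  open import Relation.Binary.PropositionalEquality
  open FiniteSets
  open Enumeration
  open Graphs
  open LinearAlgebra
    using (_·_; indicator; indicator-·; LinearlyDependent; supported-dependent; J-I-gram⇒independent)

  module _ (G : Graph) (bound : BoundedByαω G) where

    module Step (U : FSet (n G)) (ih : ∀ {W} → size W < size U → ∀ {w′} → IsOmega G W w′ → Colouring G W w′)
                {w} (ω-U : IsOmega G U w) {u} (u∈U : U u ≡ true) where

      largest-stable : IsAlpha G U (proj₁ (α-exists G U))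
      largest-stable = proj₂ (α-exists G U)

      A₀ : FSet (n G)
      A₀ = IsLargestIn.witness largest-stable

      A₀⊆U : A₀ ⊆ U
      A₀⊆U = IsLargestIn.witness⊆U largest-stable

      -- α is size A₀ itself, so that enum A₀ is indexed by Fin α.
      α : ℕ
      α = size A₀

      α-U : IsAlpha G U α
      α-U = subst (IsAlpha G U) (sym (IsLargestIn.size-witness largest-stable)) largest-stable

      M : ℕ
      M = α * w

      e : Fin α → Vertex G
      e = enum A₀

      W : Fin α → FSet (n G)
      W r = U ─ ⁅ e r ⁆

      W⊆U : ∀ r → W r ⊆ U
      W⊆U r = p─q⊆p U ⁅ e r ⁆

      colouring-W : ∀ r → Colouring G (W r) w
      colouring-W r = colouring-weaken G (largest-mono (W⊆U r) ω-W ω-U)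
        (ih (size-⊂ (W⊆U r) (A₀⊆U (e r) (enum-∈ A₀ r)) (∉─⁅⁆ U (e r))) ω-W)
        where
        ω-W : IsOmega G (W r) (proj₁ (ω-exists G (W r)))
        ω-W = proj₂ (ω-exists G (W r))

      class : Fin α → Fin w → FSet (n G)
      class r t = W r ∩ fibre (Colouring.colour (colouring-W r)) (toℕ t)

      A : Fin (suc M) → FSet (n G)
      A zero    = A₀
      A (suc k) = uncurry class (remQuot {α} w k)

      A-stable : ∀ i → Stable G (A i)
      A-stable zero    = IsLargestIn.satisfies largest-stable
      A-stable (suc k) =
        fibre-stable G (colouring-W (proj₁ (remQuot {α} w k))) (toℕ (proj₂ (remQuot {α} w k)))

      A⊆U : ∀ i → A i ⊆ U
      A⊆U zero    = A₀⊆U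
      A⊆U (suc k) x = W⊆U r x ∘ p∩q⊆p (W r) (fibre (Colouring.colour (colouring-W r)) (toℕ t)) x
        where
        r : Fin α
        r = proj₁ (remQuot {α} w k)
        t : Fin w
        t = proj₂ (remQuot {α} w k)

      -- K − e r is partitioned by the colour classes of U − e r, and A₀ ∩ K consists of the e r in K.
      ∑A∩K : ∀ K → K ⊆ U → size K ≡ w → sum (λ i → size (A i ∩ K)) ≡ M
      ∑A∩K K K⊆U |K|≡w = begin
        size (A₀ ∩ K) + sum (λ k → size (A (suc k) ∩ K))
          ≡⟨ cong₂ _+_ A₀∩K (trans (sum-combine {α} {w} (λ k → size (A (suc k) ∩ K)))
                                   (sum-cong-≗ classes∩K)) ⟩
        sum (λ r → iverson (K (e r))) + sum (λ r → size (K ─ ⁅ e r ⁆))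
          ≡⟨ ∑-distrib-+ (λ r → iverson (K (e r))) (λ r → size (K ─ ⁅ e r ⁆)) ⟨
        sum (λ r → iverson (K (e r)) + size (K ─ ⁅ e r ⁆))
          ≡⟨ sum-cong-≗ (λ r → size-remove K (e r)) ⟨
        sum {α} (λ _ → size K)
          ≡⟨ trans (sum-const α (size K)) (cong (α *_) |K|≡w) ⟩
        M ∎
        where
        open ≡-Reasoning
        A₀∩K : size (A₀ ∩ K) ≡ sum (λ r → iverson (K (e r)))
        A₀∩K = trans (sum-cong-≗ (λ x → iverson-∧ (A₀ x) (K x))) (sym (∑-enum A₀ (iverson ∘ K)))
        W∩K : ∀ r x → (W r ∩ K) x ≡ (K ─ ⁅ e r ⁆) x
        W∩K r x with K x in x∈K
        ... | true  rewrite K⊆U x x∈K = ∧-identityʳ _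
        ... | false = ∧-zeroʳ _
        classes∩K : ∀ r → sum (λ t → size (A (suc (combine r t)) ∩ K)) ≡ size (K ─ ⁅ e r ⁆)
        classes∩K r = begin
          sum (λ t → size (A (suc (combine r t)) ∩ K))
            ≡⟨ sum-cong-≗ (λ t → size-cong λ x →
                 cong (λ C → (C ∩ K) x) (cong (uncurry class) (remQuot-combine r t))) ⟩
          sum {w} (λ t → size (class r t ∩ K))
            ≡⟨ sum-cong-≗ (λ t → size-cong {S = class r t ∩ K} λ x →
                 ∧-swapʳ (W r x) (fibre colour (toℕ t) x) (K x)) ⟩
          sum {w} (λ t → size ((W r ∩ K) ∩ fibre colour (toℕ t)))
            ≡⟨ ∑-size-fibres (W r ∩ K) colour w (λ x x∈ → bounded x (∈∩⁻ˡ (W r) K x∈)) ⟩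
          size (W r ∩ K)
            ≡⟨ size-cong (W∩K r) ⟩
          size (K ─ ⁅ e r ⁆) ∎
          where
          open Colouring (colouring-W r)
          ∧-swapʳ : ∀ a b c → (a ∧ b) ∧ c ≡ (a ∧ c) ∧ b
          ∧-swapʳ a b c = trans (∧-assoc a b c) (trans (cong (a ∧_) (∧-comm b c)) (sym (∧-assoc a c b)))

      1≤M : 1 ≤ M
      1≤M = *-mono-≤ (largest>0 (stable-⁅⁆ G) u∈U α-U) (largest>0 (clique-⁅⁆ G) u∈U ω-U)

      -- Cliques K j of size ω avoiding A j would give the incidence vectors the Gram matrix J − I,
      -- making αω + 1 vectors supported on U independent, although |U| ≤ αω.
      no-avoiding-cliques : (K : Fin (suc M) → FSet (n G)) → (∀ j → Clique G (K j)) →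
        (∀ j → K j ⊆ U ─ A j) → (∀ j → size (K j) ≡ w) → ⊥
      no-avoiding-cliques K K-clique K⊆U─A |K|≡w =
        J-I-gram⇒independent 1≤M (indicator ∘ A) (indicator ∘ K) diagonal off-diagonal dependent
        where
        E : Fin (suc M) → Fin (suc M) → ℕ
        E i j = size (A i ∩ K j)
        E-diagonal : ∀ j → E j j ≡ 0
        E-diagonal j = size-empty λ x → disjoint x
          where
          disjoint : ∀ x → (A j ∩ K j) x ≡ false
          disjoint x with K j x in x∈K
          ... | true  rewrite ∈─⁻ʳ U (A j) (K⊆U─A j x x∈K) = refl
          ... | false = ∧-zeroʳ (A j x)
        E-off-diagonal : ∀ i j → i ≢ j → E i j ≡ 1
        E-off-diagonal i j = sum-saturated-except (λ i → E i j) j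
          (λ i → stable∩clique≤1 G (A-stable i) (K-clique j)) (E-diagonal j)
          (∑A∩K (K j) (⊆-trans (K⊆U─A j) (p─q⊆p U (A j))) (|K|≡w j)) i
        diagonal : ∀ j → indicator (A j) · indicator (K j) ≡ + 0
        diagonal j = trans (indicator-· (A j) (K j)) (cong +_ (E-diagonal j))
        off-diagonal : ∀ i j → i ≢ j → indicator (A i) · indicator (K j) ≡ + 1
        off-diagonal i j i≢j = trans (indicator-· (A i) (K j)) (cong +_ (E-off-diagonal i j i≢j))
        supported : ∀ i x → U x ≡ false → indicator (A i) x ≡ + 0
        supported i x x∉U with A i x in x∈A
        ... | true  = contradiction (trans (sym (A⊆U i x x∈A)) x∉U) λ ()
        ... | false = refl
        dependent : LinearlyDependent (indicator ∘ A)
        dependent = supported-dependent U (indicator ∘ A) supported (s≤s (bound U α w α-U ω-U))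

      colouring : Colouring G U w
      colouring with any? (λ i → proj₁ (ω-exists G (U ─ A i)) <? w)
      ... | yes (i , ω′<w) = colouring-weaken G ω′<w (colouring-extend G (A-stable i) (ih smaller ω-U─A))
        where
        ω-U─A : IsOmega G (U ─ A i) (proj₁ (ω-exists G (U ─ A i)))
        ω-U─A = proj₂ (ω-exists G (U ─ A i))
        smaller : size (U ─ A i) < size U
        smaller = largest<⇒size< (p─q⊆p U (A i)) ω-U─A ω-U ω′<w
      ... | no  ¬ω′<w = ⊥-elim (no-avoiding-cliques K K-clique K⊆U─A |K|≡w)
        where
        module Kᵢ (i : Fin (suc M)) = IsLargestIn (proj₂ (ω-exists G (U ─ A i)))
        K : Fin (suc M) → FSet (n G)
        K = Kᵢ.witness
        K-clique : ∀ j → Clique G (K j)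
        K-clique = Kᵢ.satisfies
        K⊆U─A : ∀ j → K j ⊆ U ─ A j
        K⊆U─A = Kᵢ.witness⊆U
        |K|≡w : ∀ j → size (K j) ≡ w
        |K|≡w j = ≤-antisym
          (IsLargestIn.maximum ω-U (K j) (K-clique j) (⊆-trans (K⊆U─A j) (p─q⊆p U (A j))))
          (subst (w ≤_) (sym (Kᵢ.size-witness j)) (≮⇒≥ (λ ω′<w → ¬ω′<w (j , ω′<w))))

    lovász : ∀ U {w} → IsOmega G U w → Colouring G U w
    lovász = size-induction (λ U → ∀ {w} → IsOmega G U w → Colouring G U w) step
      where
      step : ∀ U → (∀ {W} → size W < size U → ∀ {w} → IsOmega G W w → Colouring G W w) →
        ∀ {w} → IsOmega G U w → Colouring G U w
      step U ih ω-U with any? (λ x → U x ≟ᵇ true)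
      ... | yes (u , u∈U) = Step.colouring U ih ω-U u∈U
      ... | no  U≡∅       = colouring-empty G _ λ x → ¬-not λ x∈U → U≡∅ (x , x∈U)

module Transversals where

  open import Defs using (Graph; n)
  open import Data.Nat.Base using (ℕ; suc; _+_; _*_; _≤_; _<_; z≤n)
  open import Data.Nat.Properties
  open import Data.Bool.Base using (Bool; true; false; _∧_)
  open import Data.Bool.Properties using (∧-zeroʳ)
  open import Data.Fin.Base using (zero)
  open import Data.Product.Base using (∃; _×_; _,_; proj₁; proj₂)
  open import Relation.Nullary using (yes; no; contradiction)
  open import Relation.Binary.PropositionalEquality
  open FiniteSets
  open Graphs
  open Complement
  open Lovász

  module _ (G : Graph) where

    -- With a = α(G[U]), the stable sets in question are the maximum stable sets of G[U].
    Transversal : FSet (n G) → ℕ → FSet (n G) → Set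
    Transversal U a X = ∀ S → Stable G S → S ⊆ U → size S ≡ a → ∃ λ x → X x ≡ true × S x ≡ true

    transversal-shrinks : ∀ {U a X} → IsAlpha G U a → Transversal U a X → size (U ─ X) < size U
    transversal-shrinks {U} {a} {X} α-U X-meets with X-meets witness satisfies witness⊆U size-witness
      where open IsLargestIn α-U
    ... | x , x∈X , x∈S₀ = size-⊂ (p─q⊆p U X) (IsLargestIn.witness⊆U α-U x x∈S₀) (x∉U─X x∈X)
      where
      x∉U─X : X x ≡ true → (U ─ X) x ≡ false
      x∉U─X x∈X rewrite x∈X = ∧-zeroʳ (U x)

    transversal-lowers-α : ∀ {U a X a′} → IsAlpha G U a → Transversal U a X → IsAlpha G (U ─ X) a′ →
      a′ < a
    transversal-lowers-α {U} {a} {X} {a′} α-U X-meets α-U─X =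
      ≤∧≢⇒< (largest-mono (p─q⊆p U X) α-U─X α-U) a′≢a
      where
      open IsLargestIn α-U─X
      a′≢a : a′ ≢ a
      a′≢a a′≡a with X-meets witness satisfies (⊆-trans witness⊆U (p─q⊆p U X)) (trans size-witness a′≡a)
      ... | x , x∈X , x∈S = contradiction (trans (sym x∈X) (∈─⁻ʳ U X (witness⊆U x x∈S))) λ ()

    small-transversals⇒bounded :
      (∀ U {a w} → 0 < size U → IsAlpha G U a → IsOmega G U w →
        ∃ λ X → Transversal U a X × size X ≤ w) →
      BoundedByαω G
    small-transversals⇒bounded transversal U a w = size-induction P step U
      where
      P : FSet (n G) → Set
      P U = ∀ {a w} → IsAlpha G U a → IsOmega G U w → size U ≤ a * w
      step : ∀ U → (∀ {W} → size W < size U → P W) → P U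
      step U ih {a} {w} α-U ω-U with 0 <? size U
      ... | no  |U|≯0 = ≤-trans (≮⇒≥ |U|≯0) z≤n
      ... | yes |U|>0 with transversal U |U|>0 α-U ω-U
      ...   | X , X-meets , |X|≤w = begin
        size U
          ≡⟨ size-split U X ⟩
        size (U ∩ X) + size (U ─ X)
          ≤⟨ +-mono-≤ (size-mono (p∩q⊆q U X)) (ih (transversal-shrinks α-U X-meets) α-U─X ω-U─X) ⟩
        size X + a′ * w′
          ≤⟨ +-mono-≤ |X|≤w (*-monoʳ-≤ a′ (largest-mono (p─q⊆p U X) ω-U─X ω-U)) ⟩
        w + a′ * w
          ≤⟨ *-monoˡ-≤ w (transversal-lowers-α α-U X-meets α-U─X) ⟩
        a * w ∎
        where
        open ≤-Reasoning
        a′ w′ : ℕ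
        a′ = proj₁ (α-exists G (U ─ X))
        w′ = proj₁ (ω-exists G (U ─ X))
        α-U─X : IsAlpha G (U ─ X) a′
        α-U─X = proj₂ (α-exists G (U ─ X))
        ω-U─X : IsOmega G (U ─ X) w′
        ω-U─X = proj₂ (ω-exists G (U ─ X))

    bounded⇒clique-transversal : BoundedByαω G → ∀ {U a} → IsAlpha G U a → 0 < a →
      ∃ λ K → Clique G K × K ⊆ U × Transversal U a K
    bounded⇒clique-transversal bound {U} {suc a} α-U _ = K , K-clique , p∩q⊆p U (fibre colour 0) , K-meets
      where
      c : Colouring (complement G) U (suc a)
      c = lovász (complement G) (complement-bounded G bound) U (complement-ω G α-U)
      open Colouring c
      K : FSet (n G)
      K = U ∩ fibre colour 0
      K-clique : Clique G K
      K-clique = complement-stable⇒clique G (fibre-stable (complement G) c 0)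
      K-meets : Transversal U (suc a) K
      K-meets S S-stable S⊆U |S|≡1+a
        with clique-meets-fibres (complement G) c (stable⇒complement-clique G S-stable) S⊆U |S|≡1+a zero
      ... | x , x∈S , x-colour≡0 = x , ∈∩⁺ U (fibre colour 0) (S⊆U x x∈S) (fibre⁺ colour x-colour≡0) , x∈S

module Correspondence where

  open import Defs renaming (sym to adj-sym)
  open import Data.Nat.Base using (ℕ; zero; suc; _*_; _≤_; _<_)
  open import Data.Nat.Properties using (≤-antisym; _≤?_; *-zeroʳ) renaming (_≟_ to _≟ℕ_)
  open import Data.Bool.Base using (Bool; true; false)
  open import Data.Bool.Properties using () renaming (_≟_ to _≟ᵇ_)
  open import Data.Fin.Base using (Fin; zero; suc; toℕ; fromℕ<)
  open import Data.Fin.Properties using (all?; any?; toℕ<n; toℕ-fromℕ<; toℕ-injective) renaming (_≟_ to _≟ᶠ_)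
  open import Data.Fin.Subset using (Subset; ⊤; ∣_∣; _∈_)
  open import Data.Fin.Subset.Properties using (_∈?_; anySubset?; ∈⊤)
  open import Data.Vec.Base using ([]; _∷_; lookup; tabulate)
  open import Data.Vec.Properties using ([]=⇒lookup; lookup⇒[]=; lookup∘tabulate)
  open import Data.Product.Base using (∃; _×_; _,_)
  open import Function.Base using (_∘_)
  open import Relation.Nullary using (Dec; does; yes; ¬?; contradiction)
  open import Relation.Nullary.Decidable using (_×-dec_; _→-dec_; map′; decidable-stable; dec-true)
  open import Relation.Binary.PropositionalEquality
  open FiniteSets
  open Enumeration
  open Search
  open Graphs
  open Transversals

  toFSet : ∀ {N} → Subset N → FSet N
  toFSet S = lookup S

  fromFSet : ∀ {N} → FSet N → Subset N
  fromFSet = tabulate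

  ∈⇒toFSet : ∀ {N} {S : Subset N} {x} → x ∈ S → toFSet S x ≡ true
  ∈⇒toFSet = []=⇒lookup

  toFSet⇒∈ : ∀ {N} {S : Subset N} {x} → toFSet S x ≡ true → x ∈ S
  toFSet⇒∈ {S = S} {x} = lookup⇒[]= x S

  toFSet∘fromFSet : ∀ {N} (f : FSet N) x → toFSet (fromFSet f) x ≡ f x
  toFSet∘fromFSet = lookup∘tabulate

  ∣∣≡size : ∀ {N} (S : Subset N) → ∣ S ∣ ≡ size (toFSet S)
  ∣∣≡size []          = refl
  ∣∣≡size (true ∷ S)  = cong suc (∣∣≡size S)
  ∣∣≡size (false ∷ S) = ∣∣≡size S

  ∣fromFSet∣ : ∀ {N} (f : FSet N) → ∣ fromFSet f ∣ ≡ size f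
  ∣fromFSet∣ f = trans (∣∣≡size (fromFSet f)) (size-cong (toFSet∘fromFSet f))

  allSubsets? : ∀ {N} {P : Subset N → Set} → (∀ S → Dec (P S)) → Dec (∀ S → P S)
  allSubsets? P? = map′ (λ ∄¬P S → decidable-stable (P? S) (λ ¬PS → ∄¬P (S , ¬PS)))
                        (λ ∀P (S , ¬PS) → ¬PS (∀P S))
                        (¬? (anySubset? (¬? ∘ P?)))

  module _ (H : Graph) where

    stable⇒ : ∀ {S} → IsStable H S → Stable H (toFSet S)
    stable⇒ S-stable x y x∈S y∈S = S-stable x y (toFSet⇒∈ x∈S) (toFSet⇒∈ y∈S)

    stable⇐ : ∀ {S} → Stable H (toFSet S) → IsStable H S
    stable⇐ S-stable x y x∈S y∈S = S-stable x y (∈⇒toFSet x∈S) (∈⇒toFSet y∈S)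

    clique⇒ : ∀ {S} → IsClique H S → Clique H (toFSet S)
    clique⇒ S-clique x y x∈S y∈S = S-clique x y (toFSet⇒∈ x∈S) (toFSet⇒∈ y∈S)

    clique⇐ : ∀ {S} → Clique H (toFSet S) → IsClique H S
    clique⇐ S-clique x y x∈S y∈S = S-clique x y (∈⇒toFSet x∈S) (∈⇒toFSet y∈S)

    stable-fromFSet : ∀ {f} → Stable H f → IsStable H (fromFSet f)
    stable-fromFSet {f} f-stable = stable⇐ (stable-resp H (λ x → sym (toFSet∘fromFSet f x)) f-stable)

    clique-fromFSet : ∀ {f} → Clique H f → IsClique H (fromFSet f)
    clique-fromFSet {f} f-clique = clique⇐ (clique-resp H (λ x → sym (toFSet∘fromFSet f x)) f-clique)

    cliqueNumber⇒ω : ∀ {w} → IsCliqueNumber H w → IsOmega H full w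
    cliqueNumber⇒ω {w} ((K , K-clique , |K|≡w) , maximum) = record
      { witness = toFSet K ; satisfies = clique⇒ K-clique ; witness⊆U = λ _ _ → refl
      ; size-witness = trans (sym (∣∣≡size K)) |K|≡w
      ; maximum = λ K′ K′-clique _ →
          subst (_≤ w) (∣fromFSet∣ K′) (maximum (fromFSet K′) (clique-fromFSet K′-clique)) }

    ω⇒cliqueNumber : ∀ {w} → IsOmega H full w → IsCliqueNumber H w
    ω⇒cliqueNumber {w} ω-H =
      (fromFSet witness , clique-fromFSet satisfies , trans (∣fromFSet∣ witness) size-witness) ,
      λ S S-clique → subst (_≤ w) (sym (∣∣≡size S)) (maximum (toFSet S) (clique⇒ S-clique) (λ _ _ → refl))
      where open IsLargestIn ω-H

    maximumStable⇒ : ∀ {a S} → IsAlpha H full a → IsMaximumStable H S →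
      Stable H (toFSet S) × size (toFSet S) ≡ a
    maximumStable⇒ {a} {S} α-H (S-stable , S-maximum) = stable⇒ S-stable , ≤-antisym
      (maximum (toFSet S) (stable⇒ S-stable) (λ _ _ → refl))
      (subst₂ _≤_ (trans (∣fromFSet∣ witness) size-witness) (∣∣≡size S)
        (S-maximum (fromFSet witness) (stable-fromFSet satisfies)))
      where open IsLargestIn α-H

    maximumStable⇐ : ∀ {a T} → IsAlpha H full a → Stable H T → size T ≡ a → IsMaximumStable H (fromFSet T)
    maximumStable⇐ {a} {T} α-H T-stable |T|≡a = stable-fromFSet T-stable , λ S S-stable →
      subst₂ _≤_ (sym (∣∣≡size S)) (sym (trans (∣fromFSet∣ T) |T|≡a))
        (IsLargestIn.maximum α-H (toFSet S) (stable⇒ S-stable) (λ _ _ → refl))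

    transversal⇒ : ∀ {a X} → IsAlpha H full a → IsTransversal H X → Transversal H full a (toFSet X)
    transversal⇒ α-H X-meets S S-stable _ |S|≡a with X-meets (fromFSet S) (maximumStable⇐ α-H S-stable |S|≡a)
    ... | x , x∈X , x∈S = x , ∈⇒toFSet x∈X , trans (sym (toFSet∘fromFSet S x)) (∈⇒toFSet x∈S)

    transversal⇐ : ∀ {a K} → IsAlpha H full a → Transversal H full a K → IsTransversal H (fromFSet K)
    transversal⇐ {K = K} α-H K-meets S S-maximum
      with S-stable , |S|≡a ← maximumStable⇒ α-H S-maximum
      with x , x∈K , x∈S ← K-meets (toFSet S) S-stable (λ _ _ → refl) |S|≡a =
      x , toFSet⇒∈ (trans (toFSet∘fromFSet K x) x∈K) , toFSet⇒∈ x∈S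

    proper⇒colouring : ∀ {k} {c : Fin (n H) → Fin k} → IsProperColouring H k c → Colouring H full k
    proper⇒colouring {k} {c} c-proper = record
      { colour = toℕ ∘ c ; bounded = λ x _ → toℕ<n (c x)
      ; proper = λ x y _ _ xy → c-proper x y xy ∘ toℕ-injective }

    colouring⇒proper : ∀ {k} → Colouring H full k → ∃ (IsProperColouring H k)
    colouring⇒proper {k} c = colour′ , λ x y xy eq → proper x y refl refl xy (colour′-injective eq)
      where
      open Colouring c
      colour′ : Fin (n H) → Fin k
      colour′ x = fromℕ< (bounded x refl)
      colour′-injective : ∀ {x y} → colour′ x ≡ colour′ y → colour x ≡ colour y
      colour′-injective {x} {y} eq =
        trans (sym (toℕ-fromℕ< (bounded x refl))) (trans (cong toℕ eq) (toℕ-fromℕ< (bounded y refl)))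

    isStable? : ∀ S → Dec (IsStable H S)
    isStable? S = all? λ x → all? λ y → (x ∈? S) →-dec (y ∈? S) →-dec (adj H x y ≟ᵇ false)

    isMaximumStable? : ∀ S → Dec (IsMaximumStable H S)
    isMaximumStable? S = isStable? S ×-dec allSubsets? (λ T → isStable? T →-dec ∣ T ∣ ≤? ∣ S ∣)

    transversal? : ∀ X → Dec (IsTransversal H X)
    transversal? X = allSubsets? λ S → isMaximumStable? S →-dec any? (λ x → (x ∈? X) ×-dec (x ∈? S))

    ⊤-transversal : 0 < n H → IsTransversal H ⊤
    ⊤-transversal 0<n S (S-stable , S-maximum) with size>0⇒nonempty (toFSet S) |S|>0
      where
      v : Fin (n H)
      v = fromℕ< 0<n
      |S|>0 : 0 < size (toFSet S)
      |S|>0 = subst₂ _≤_ (trans (∣fromFSet∣ ⁅ v ⁆) (size-⁅⁆ v)) (∣∣≡size S)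
        (S-maximum (fromFSet ⁅ v ⁆) (stable-fromFSet (stable-⁅⁆ H v)))
    ... | x , x∈S = x , ∈⊤ , toFSet⇒∈ x∈S

    opaque
      χ-exists : ∃ (IsChromaticNumber H)
      χ-exists with least colourable? identity-colouring-proper
        where
        Colourable : ℕ → Set
        Colourable k = ∃ (IsProperColouring H k)
        colourable? : ∀ k → Dec (Colourable k)
        colourable? k = search-functions search-Fin
          (λ c≗c′ c-proper x y xy eq → c-proper x y xy (trans (c≗c′ x) (trans eq (sym (c≗c′ y)))))
          (λ c → all? λ x → all? λ y → (adj H x y ≟ᵇ true) →-dec ¬? (c x ≟ᶠ c y))
        identity-colouring-proper : Colourable (n H)
        identity-colouring-proper = (λ x → x) , λ x y xy x≡y →
          contradiction (trans (sym xy) (subst (λ z → adj H x z ≡ false) x≡y (irrfl H x))) λ ()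
      ... | χ , colouring , minimal = χ , colouring , λ k c c-proper → minimal k (c , c-proper)

      η-exists : 0 < n H → ∃ (IsEta H)
      η-exists 0<n with least transversal-of-size? (⊤ , ⊤-transversal 0<n , refl)
        where
        transversal-of-size? : ∀ k → Dec (∃ λ X → IsTransversal H X × ∣ X ∣ ≡ k)
        transversal-of-size? k = anySubset? λ X → transversal? X ×-dec ∣ X ∣ ≟ℕ k
      ... | η , transversal , minimal = η , transversal , λ X X-meets → minimal ∣ X ∣ (X , X-meets , refl)

  module Restriction (H : Graph) (U : FSet (n H)) where

    restriction : Graph
    restriction = induced H (enum U)

    restriction-induced : ∀ {G} → IsInducedSubgraphOf H G → IsInducedSubgraphOf restriction G
    restriction-induced (f , f-injective , f-adj) =
      f ∘ enum U , enum-injective U ∘ f-injective , λ i j → f-adj (enum U i) (enum U j)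

    image : FSet (size U) → FSet (n H)
    image T x = does (any? λ i → (enum U i ≟ᶠ x) ×-dec (T i ≟ᵇ true))

    image⁻ : ∀ T {x} → image T x ≡ true → ∃ λ i → enum U i ≡ x × T i ≡ true
    image⁻ T {x} x∈image with any? (λ i → (enum U i ≟ᶠ x) ×-dec (T i ≟ᵇ true))
    ... | yes found = found

    image⁺ : ∀ T {i} → T i ≡ true → image T (enum U i) ≡ true
    image⁺ T {i} i∈T = dec-true (any? λ j → (enum U j ≟ᶠ enum U i) ×-dec (T j ≟ᵇ true)) (i , refl , i∈T)

    image⊆U : ∀ T → image T ⊆ U
    image⊆U T x x∈image with image⁻ T x∈image
    ... | i , refl , _ = enum-∈ U i

    image-enum : ∀ T i → image T (enum U i) ≡ T i
    image-enum T i with T i in i∈T | image T (enum U i) in ei∈image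
    ... | true  | b     = trans (sym ei∈image) (image⁺ T i∈T)
    ... | false | false = refl
    ... | false | true  with image⁻ T ei∈image
    ...   | j , ej≡ei , j∈T rewrite enum-injective U ej≡ei = sym (trans (sym i∈T) j∈T)

    size-preimage : ∀ S → S ⊆ U → size (S ∘ enum U) ≡ size S
    size-preimage S S⊆U = trans (∑-enum U (iverson ∘ S)) (sum-cong-≗ inside)
      where
      inside : ∀ x → iverson (U x) * iverson (S x) ≡ iverson (S x)
      inside x with S x in x∈S
      ... | true  rewrite S⊆U x x∈S = refl
      ... | false = *-zeroʳ (iverson (U x))

    size-image : ∀ T → size (image T) ≡ size T
    size-image T = trans (sym (size-preimage (image T) (image⊆U T))) (size-cong (image-enum T))

    restriction-largest : ∀ {P : FSet (n H) → Set} {Q : FSet (size U) → Set} {w} →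
      (∀ S → P S → Q (S ∘ enum U)) → (∀ T → Q T → P (image T)) → IsLargestIn P U w → IsLargestIn Q full w
    restriction-largest P⇒Q Q⇒P largest = record
      { witness = witness ∘ enum U ; satisfies = P⇒Q witness satisfies ; witness⊆U = λ _ _ → refl
      ; size-witness = trans (size-preimage witness witness⊆U) size-witness
      ; maximum = λ T QT _ → subst (_≤ _) (size-image T) (maximum (image T) (Q⇒P T QT) (image⊆U T)) }
      where open IsLargestIn largest

    stable-preimage : ∀ S → Stable H S → Stable restriction (S ∘ enum U)
    stable-preimage S S-stable i j = S-stable (enum U i) (enum U j)

    stable-image : ∀ T → Stable restriction T → Stable H (image T)
    stable-image T T-stable x y x∈T y∈T with image⁻ T x∈T | image⁻ T y∈T
    ... | i , refl , i∈T | j , refl , j∈T = T-stable i j i∈T j∈T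

    clique-preimage : ∀ S → Clique H S → Clique restriction (S ∘ enum U)
    clique-preimage S S-clique i j i∈S j∈S i≢j =
      S-clique (enum U i) (enum U j) i∈S j∈S (i≢j ∘ enum-injective U)

    clique-image : ∀ T → Clique restriction T → Clique H (image T)
    clique-image T T-clique x y x∈T y∈T x≢y with image⁻ T x∈T | image⁻ T y∈T
    ... | i , refl , i∈T | j , refl , j∈T = T-clique i j i∈T j∈T (x≢y ∘ cong (enum U))

    restriction-α : ∀ {a} → IsAlpha H U a → IsAlpha restriction full a
    restriction-α = restriction-largest stable-preimage stable-image

    restriction-ω : ∀ {w} → IsOmega H U w → IsOmega restriction full w
    restriction-ω = restriction-largest clique-preimage clique-image

    transversal-image : ∀ {a X} → Transversal restriction full a X → Transversal H U a (image X)
    transversal-image {X = X} X-meets S S-stable S⊆U |S|≡a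
      with X-meets (S ∘ enum U) (stable-preimage S S-stable) (λ _ _ → refl)
                   (trans (size-preimage S S⊆U) |S|≡a)
    ... | i , i∈X , i∈S = enum U i , image⁺ X i∈X , i∈S

open import Defs renaming (sym to adj-sym)
open import Data.Nat.Base using (_*_; _≤_; _<_)
open import Data.Nat.Properties using (≤-trans; *-monoˡ-≤; *-comm; module ≤-Reasoning)
open import Data.Fin.Base using (fromℕ<)
open import Data.Fin.Subset using (∣_∣)
open import Data.Product.Base using (∃; _×_; _,_; proj₂)
open import Relation.Binary.PropositionalEquality
open FiniteSets
open Graphs
open Lovász
open Transversals
open Correspondence

perfect⇒bounded : ∀ G → Perfect G → ∀ H → IsInducedSubgraphOf H G → BoundedByαω H
perfect⇒bounded G perfect H H⊆G U a w α-U ω-U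
  with χ , χ-HU@((_ , χ-proper) , _) ← χ-exists (Restriction.restriction H U) = begin
  size U
    ≡⟨ size-full ⟨
  size (full {size U})
    ≤⟨ size≤colours*α restriction (proper⇒colouring restriction χ-proper) (restriction-α α-U) ⟩
  χ * a
    ≤⟨ *-monoˡ-≤ a χ≤w ⟩
  w * a
    ≡⟨ *-comm w a ⟩
  a * w ∎
  where
  open ≤-Reasoning
  open Restriction H U
  χ≤w : χ ≤ w
  χ≤w = perfect restriction (restriction-induced {G} H⊆G) χ w χ-HU
          (ω⇒cliqueNumber restriction (restriction-ω ω-U))

bounded⇒χ≤ω : ∀ H {χ ω} → BoundedByαω H → IsChromaticNumber H χ → IsCliqueNumber H ω → χ ≤ ω
bounded⇒χ≤ω H {ω = ω} bound (_ , minimal) ω-H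
  with c , c-proper ← colouring⇒proper H (lovász H bound full (cliqueNumber⇒ω H ω-H)) = minimal ω c c-proper

η-bounded⇒bounded : ∀ G → EtaBounded G → ∀ H → IsInducedSubgraphOf H G → BoundedByαω H
η-bounded⇒bounded G η≤ω H H⊆G = small-transversals⇒bounded H small-transversal
  where
  small-transversal : ∀ U {a w} → 0 < size U → IsAlpha H U a → IsOmega H U w →
    ∃ λ X → Transversal H U a X × size X ≤ w
  small-transversal U {a} {w} |U|>0 α-U ω-U
    with η , η-HU@((X , X-meets , |X|≡η) , _) ← η-exists (Restriction.restriction H U) |U|>0 =
    image (toFSet X) , transversal-image (transversal⇒ restriction (restriction-α α-U) X-meets) , |image|≤w
    where
    open Restriction H U
    |image|≤w : size (image (toFSet X)) ≤ w
    |image|≤w = begin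
      size (image (toFSet X)) ≡⟨ size-image (toFSet X) ⟩
      size (toFSet X)         ≡⟨ ∣∣≡size X ⟨
      ∣ X ∣                   ≡⟨ |X|≡η ⟩
      η                       ≤⟨ η≤ω restriction (restriction-induced {G} H⊆G) |U|>0 η w η-HU
                                   (ω⇒cliqueNumber restriction (restriction-ω ω-U)) ⟩
      w                       ∎
      where open ≤-Reasoning

perfect⇒η-bounded : ∀ G → Perfect G → EtaBounded G
perfect⇒η-bounded G perfect H H⊆G 0<n η ω η-H ω-H
  with a , α-H ← α-exists H full
  with K , K-clique , _ , K-meets ← bounded⇒clique-transversal H (perfect⇒bounded G perfect H H⊆G) α-H
                                      (largest>0 {u = fromℕ< 0<n} (stable-⁅⁆ H) refl α-H) =
  ≤-trans (proj₂ η-H (fromFSet K) (transversal⇐ H α-H K-meets))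
          (proj₂ ω-H (fromFSet K) (clique-fromFSet H K-clique))

η-bounded⇒perfect : ∀ G → EtaBounded G → Perfect G
η-bounded⇒perfect G η≤ω H H⊆G χ ω = bounded⇒χ≤ω H (η-bounded⇒bounded G η≤ω H H⊆G)

theorem1p5 : (G : Graph) → (Perfect G → EtaBounded G) × (EtaBounded G → Perfect G)
theorem1p5 G = perfect⇒η-bounded G , η-bounded⇒perfect G
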